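{- Let $N\ge2$, $1\le r\le N-1$ and $k\in\mathbb{Z}$. Consider the state with $N+1$ violinists, at most one per room, consisting of one violinist in room $k$ together with $N$ violinists whose occupancy pattern is the shadow $F_{N,r}$ with leftmost violinist in room $k+1$ (and no other violinists). Then the only final state reachable from this state is the state with shadow $F_{N+1,r}$ whose leftmost violinist is in room $k-1$.
   Context: Rooms are indexed by the integers, room $i$ adjacent to rooms $i\pm1$. A state is a finite placement of indistinguishable violinists in rooms. A move is possible whenever two adjacent rooms $i,i+1$ are both occupied: one violinist leaves room $i$ for the nearest unoccupied room to the left of $i$, and one violinist leaves room $i+1$ for the nearest unoccupied room to the right of $i+1$. A state is final if no move is possible; reachable means obtained by a finite (possibly empty) sequence of moves. For a state with at most one violinist per room, its shadow is its $0/1$ occupancy word from leftmost to rightmost occupied room. For $N\ge2$ and $1\le k\le N-1$, $F_{N,k}$ is the shadow with $N$ ones in which consecutive ones are separated by a single $0$, except the $k$-th and $(k+1)$-st ones, separated by $00$ (e.g. $F_{3,2}=101001$). -}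

module Defs where

open import Data.Nat using (ℕ; zero; suc; _∸_; _≥_; _<_)
open import Data.Integer as ℤ using (ℤ; +_; -[1+_]; _-_)
import Data.Integer as Z
open import Data.Bool using (Bool; true; false; if_then_else_)
open import Data.List using (List; []; _∷_; _++_)
open import Data.Product using (Σ; ∃; _×_; _,_)
open import Relation.Nullary using (¬_)
open import Relation.Nullary.Decidable using (⌊_⌋)
open import Relation.Binary.PropositionalEquality using (_≡_)
open import Relation.Binary.Construct.Closure.ReflexiveTransitive using (Star)

-- A state: number of violinists in each room (rooms indexed by ℤ).
State : Set
State = ℤ → ℕ

NearestLeftEmpty : State → ℤ → ℤ → Set
NearestLeftEmpty s i a = (a Z.< i) × (s a ≡ 0) × (∀ j → a Z.< j → j Z.< i → s j ≥ 1)

NearestRightEmpty : State → ℤ → ℤ → Set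
NearestRightEmpty s i b = (i Z.< b) × (s b ≡ 0) × (∀ j → i Z.< j → j Z.< b → s j ≥ 1)

δ : ℤ → ℤ → ℕ
δ x y = if ⌊ x Z.≟ y ⌋ then 1 else 0

-- One move at the pair (i, i+1): one violinist goes from i to a, one from i+1 to b.
Move : State → State → Set
Move s t = ∃ λ i → ∃ λ a → ∃ λ b →
    (s i ≥ 1) × (s (i Z.+ + 1) ≥ 1)
  × NearestLeftEmpty s i a × NearestRightEmpty s (i Z.+ + 1) b
  × (∀ x → t x Data.Nat.+ δ x i Data.Nat.+ δ x (i Z.+ + 1)
           ≡ s x Data.Nat.+ δ x a Data.Nat.+ δ x b)

Reachable : State → State → Set
Reachable = Star Move

Final : State → Set
Final s = ¬ (∃ λ i → (s i ≥ 1) × (s (i Z.+ + 1) ≥ 1))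

block : ℕ → List Bool
block zero = []
block (suc zero) = true ∷ []
block (suc (suc m)) = true ∷ false ∷ block (suc m)

F : ℕ → ℕ → List Bool
F N r = block r ++ (false ∷ false ∷ block (N ∸ r))

nth : List Bool → ℕ → ℕ
nth [] n = 0
nth (b ∷ w) zero = if b then 1 else 0
nth (b ∷ w) (suc n) = nth w n

place : List Bool → ℤ → State
place w p x with x - p
... | + n = nth w n
... | -[1+ _ ] = 0

_≈_ : State → State → Set
s ≈ t = ∀ x → s x ≡ t x

-- Measure rooms from k − 1 and describe states by their occupancy words there. The initial
-- state is 01 (10)^r (01)^m with m = N − r, and the claimed final state is (10)^r 01 (01)^m.
-- Every word (10)^j 01 (10)^d (01)^m has at most one pair of adjacent occupied rooms, the 11 right
-- after (10)^j 0, present exactly when d > 0; the move there turns the surrounding 0110 into 1001,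
-- giving (10)^(j+1) 01 (10)^(d−1) (01)^m. So every play from the initial state is forced through
-- these words with j = 0, 1, …, r and stops only at j = r.
module Submission where

open import Defs
open import Data.Nat using (ℕ; _≤_; _∸_; _+_)
open import Data.Integer using (ℤ; +_; _-_)
open import Data.Product using (_×_; Σ)

open import Data.Nat using (zero; suc; _<_; _≥_; z≤n; s≤s)
import Data.Nat.Properties as ℕₚ
open import Data.Integer as ℤ using (-[1+_])
import Data.Integer.Properties as ℤₚ
open import Data.Integer.Tactic.RingSolver using (solve-∀)
open import Data.Bool using (Bool; true; false)
open import Data.List using (List; []; _∷_; _++_; length)
open import Data.Product using (∃; _,_; proj₁; proj₂)
open import Data.Empty using (⊥-elim)
open import Relation.Nullary using (¬_; yes; no)
open import Relation.Binary.Definitions using (tri<; tri≈; tri>)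
open import Relation.Binary.PropositionalEquality
open import Relation.Binary.Construct.Closure.ReflexiveTransitive using (ε; _◅_)

i-j+j≡i : ∀ i j → (i - j) ℤ.+ j ≡ i
i-j+j≡i = solve-∀

j+i-j≡i : ∀ j i → (j ℤ.+ i) - j ≡ i
j+i-j≡i = solve-∀

[i+1]-j≡[i-j]+1 : ∀ i j → (i ℤ.+ + 1) - j ≡ (i - j) ℤ.+ + 1
[i+1]-j≡[i-j]+1 = solve-∀

k-[k-1]≡1 : ∀ k → k - (k - + 1) ≡ + 1
k-[k-1]≡1 = solve-∀

x-[k+1]≡[x-[k-1]]-2 : ∀ x k → x - (k ℤ.+ + 1) ≡ (x - (k - + 1)) - + 2
x-[k+1]≡[x-[k-1]]-2 = solve-∀

i-k≡j-k⇒i≡j : ∀ k {i j} → i - k ≡ j - k → i ≡ j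
i-k≡j-k⇒i≡j k {i} {j} e = trans (sym (i-j+j≡i i k)) (trans (cong (ℤ._+ k) e) (i-j+j≡i j k))

i<i+1 : ∀ i → i ℤ.< i ℤ.+ + 1
i<i+1 i = ℤₚ.suc[i]≤j⇒i<j (ℤₚ.≤-reflexive (ℤₚ.+-comm (+ 1) i))

i<j⇒j≮i+1 : ∀ {i j} → i ℤ.< j → ¬ j ℤ.< i ℤ.+ + 1
i<j⇒j≮i+1 {i} i<j j<i+1 =
  ℤₚ.<-irrefl (ℤₚ.+-comm (+ 1) i) (ℤₚ.≤-<-trans (ℤₚ.i<j⇒suc[i]≤j i<j) j<i+1)

δ-cong : ∀ {x y x′ y′} → (x ≡ y → x′ ≡ y′) → (x′ ≡ y′ → x ≡ y) → δ x y ≡ δ x′ y′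
δ-cong {x} {y} {x′} {y′} to from with x ℤ.≟ y | x′ ℤ.≟ y′
... | yes _  | yes _   = refl
... | no _   | no _    = refl
... | yes eq | no ¬eq  = ⊥-elim (¬eq (to eq))
... | no ¬eq | yes eq  = ⊥-elim (¬eq (from eq))

δ-+-suc : ∀ m n → δ (+ suc m) (+ suc n) ≡ δ (+ m) (+ n)
δ-+-suc m n = δ-cong (λ e → cong +_ (ℕₚ.suc-injective (ℤₚ.+-injective e)))
                     (λ e → cong (λ k → + suc k) (ℤₚ.+-injective e))

δ-translate : ∀ p x y → δ x y ≡ δ (x - p) (y - p)
δ-translate p x y = δ-cong (cong (_- p)) (i-k≡j-k⇒i≡j p)

δ-at : ∀ p x n → δ x (p ℤ.+ + n) ≡ δ (x - p) (+ n)
δ-at p x n = trans (δ-translate p x _) (cong (δ (x - p)) (j+i-j≡i p (+ n)))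

nthℤ : List Bool → ℤ → ℕ
nthℤ w (+ n)    = nth w n
nthℤ w -[1+ _ ] = 0

place-nthℤ : ∀ w p x → place w p x ≡ nthℤ w (x - p)
place-nthℤ w p x with x - p
... | + n      = refl
... | -[1+ _ ] = refl

place-at : ∀ w p n → place w p (p ℤ.+ + n) ≡ nth w n
place-at w p n = trans (place-nthℤ w p (p ℤ.+ + n)) (cong (nthℤ w) (j+i-j≡i p (+ n)))

nth-++ʳ : ∀ u w n → nth (u ++ w) (length u + n) ≡ nth w n
nth-++ʳ []      w n = refl
nth-++ʳ (_ ∷ u) w n = nth-++ʳ u w n

nthℤ-01∷ : ∀ w z → nthℤ (false ∷ true ∷ w) z ≡ δ z (+ 1) + nthℤ w (z - + 2)
nthℤ-01∷ w -[1+ _ ]        = refl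
nthℤ-01∷ w (+ 0)           = refl
nthℤ-01∷ w (+ 1)           = refl
nthℤ-01∷ w (+ suc (suc n)) = refl

place-01∷ : ∀ w k x → place (false ∷ true ∷ w) (k - + 1) x ≡ δ x k + place w (k ℤ.+ + 1) x
place-01∷ w k x = begin
  place (false ∷ true ∷ w) (k - + 1) x            ≡⟨ place-nthℤ _ (k - + 1) x ⟩
  nthℤ (false ∷ true ∷ w) (x - (k - + 1))          ≡⟨ nthℤ-01∷ w z ⟩
  δ z (+ 1) + nthℤ w (z - + 2)                     ≡⟨ cong₂ _+_ (sym δk) (cong (nthℤ w) (sym shift)) ⟩
  δ x k + nthℤ w (x - (k ℤ.+ + 1))                 ≡⟨ cong (λ n → δ x k + n) (sym (place-nthℤ w _ x)) ⟩
  δ x k + place w (k ℤ.+ + 1) x                    ∎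
  where
  open ≡-Reasoning
  z = x - (k - + 1)
  δk : δ x k ≡ δ z (+ 1)
  δk = trans (δ-translate (k - + 1) x k) (cong (δ z) (k-[k-1]≡1 k))
  shift : x - (k ℤ.+ + 1) ≡ z - + 2
  shift = x-[k+1]≡[x-[k-1]]-2 x k

NearestLeftEmpty-unique : ∀ {s i a a′} → NearestLeftEmpty s i a → NearestLeftEmpty s i a′ → a ≡ a′
NearestLeftEmpty-unique {a = a} {a′} (a<i , sa≡0 , full) (a′<i , sa′≡0 , full′) with ℤₚ.<-cmp a a′
... | tri< a<a′ _ _ = ⊥-elim (ℕₚ.n≮0 (subst (1 ≤_) sa′≡0 (full a′ a<a′ a′<i)))
... | tri≈ _ a≡a′ _ = a≡a′
... | tri> _ _ a′<a = ⊥-elim (ℕₚ.n≮0 (subst (1 ≤_) sa≡0 (full′ a a′<a a<i)))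

NearestRightEmpty-unique : ∀ {s i b b′} → NearestRightEmpty s i b → NearestRightEmpty s i b′ → b ≡ b′
NearestRightEmpty-unique {b = b} {b′} (i<b , sb≡0 , full) (i<b′ , sb′≡0 , full′) with ℤₚ.<-cmp b b′
... | tri< b<b′ _ _ = ⊥-elim (ℕₚ.n≮0 (subst (1 ≤_) sb≡0 (full′ b i<b b<b′)))
... | tri≈ _ b≡b′ _ = b≡b′
... | tri> _ _ b′<b = ⊥-elim (ℕₚ.n≮0 (subst (1 ≤_) sb′≡0 (full b′ i<b′ b′<b)))

nearestLeftEmpty-adjacent : ∀ {s a i} → i ≡ a ℤ.+ + 1 → s a ≡ 0 → NearestLeftEmpty s i a
nearestLeftEmpty-adjacent {a = a} refl sa≡0 =
  i<i+1 a , sa≡0 , λ j a<j j<i → ⊥-elim (i<j⇒j≮i+1 a<j j<i)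

nearestRightEmpty-adjacent : ∀ {s i b} → b ≡ i ℤ.+ + 1 → s b ≡ 0 → NearestRightEmpty s i b
nearestRightEmpty-adjacent {i = i} refl sb≡0 =
  i<i+1 i , sb≡0 , λ j i<j j<b → ⊥-elim (i<j⇒j≮i+1 i<j j<b)

move-between-holes : ∀ {s t} q →
  s (q ℤ.+ + 0) ≡ 0 → s (q ℤ.+ + 1) ≥ 1 → s (q ℤ.+ + 2) ≥ 1 → s (q ℤ.+ + 3) ≡ 0 →
  (∀ x → t x + δ x (q ℤ.+ + 1) + δ x (q ℤ.+ + 2) ≡ s x + δ x (q ℤ.+ + 0) + δ x (q ℤ.+ + 3)) →
  Move s t
move-between-holes {s} {t} q s₀≡0 s₁≥1 s₂≥1 s₃≡0 conserve =
    q ℤ.+ + 1 , q ℤ.+ + 0 , q ℤ.+ + 3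
  , s₁≥1 , subst (λ y → s y ≥ 1) (next 1) s₂≥1
  , nearestLeftEmpty-adjacent (next 0) s₀≡0
  , nearestRightEmpty-adjacent (trans (next 2) (cong (ℤ._+ + 1) (next 1))) s₃≡0
  , λ x → subst (λ y → t x + δ x (q ℤ.+ + 1) + δ x y ≡ s x + δ x (q ℤ.+ + 0) + δ x (q ℤ.+ + 3))
                (next 1) (conserve x)
  where
  next : ∀ k → q ℤ.+ (+ k ℤ.+ + 1) ≡ (q ℤ.+ + k) ℤ.+ + 1
  next k = sym (ℤₚ.+-assoc q (+ k) (+ 1))

move-deterministic : ∀ {s t u} (m : Move s t) (m′ : Move s u) → proj₁ m ≡ proj₁ m′ → t ≈ u
move-deterministic (i , a , b , _ , _ , left , right , conserve)
                   (.i , a′ , b′ , _ , _ , left′ , right′ , conserve′) refl x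
  with NearestLeftEmpty-unique left left′ | NearestRightEmpty-unique right right′
... | refl | refl = ℕₚ.+-cancelʳ-≡ _ _ _ (ℕₚ.+-cancelʳ-≡ _ _ _ (trans (conserve x) (sym (conserve′ x))))

move-resp : ∀ {s s′ t} → s ≈ s′ → Move s′ t → Move s t
move-resp {s} {s′} {t} s≈s′ (i , a , b , si , si+1 , (a<i , sa , left) , (i<b , sb , right) , conserve) =
    i , a , b , occupied si , occupied si+1
  , (a<i , trans (s≈s′ a) sa , λ j p q → occupied (left j p q))
  , (i<b , trans (s≈s′ b) sb , λ j p q → occupied (right j p q))
  , λ x → subst (λ n → t x + δ x i + δ x (i ℤ.+ + 1) ≡ n + δ x a + δ x b) (sym (s≈s′ x)) (conserve x)
  where
  occupied : ∀ {y} → s′ y ≥ 1 → s y ≥ 1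
  occupied {y} = subst (_≥ 1) (sym (s≈s′ y))

final-no-move : ∀ {s t} → Final s → ¬ Move s t
final-no-move final (i , _ , _ , si , si+1 , _) = final (i , si , si+1)

AdjacentOnes : List Bool → ℕ → Set
AdjacentOnes w n = nth w n ≥ 1 × nth w (n + 1) ≥ 1

adjacent-nthℤ : ∀ w z → nthℤ w z ≥ 1 → nthℤ w (z ℤ.+ + 1) ≥ 1 → ∃ λ n → z ≡ + n × AdjacentOnes w n
adjacent-nthℤ w (+ n)    wn≥1 wn+1≥1 = n , refl , wn≥1 , wn+1≥1
adjacent-nthℤ w -[1+ _ ] ()   _

adjacent-place : ∀ w p i → place w p i ≥ 1 → place w p (i ℤ.+ + 1) ≥ 1 →
                 ∃ λ n → i ≡ p ℤ.+ + n × AdjacentOnes w n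
adjacent-place w p i si≥1 si+1≥1
  with adjacent-nthℤ w (i - p) (subst (_≥ 1) (place-nthℤ w p i) si≥1)
         (subst (λ z → nthℤ w z ≥ 1) ([i+1]-j≡[i-j]+1 i p) (subst (_≥ 1) (place-nthℤ w p (i ℤ.+ + 1)) si+1≥1))
... | n , i-p≡n , adjacent = n , i-k≡j-k⇒i≡j p (trans i-p≡n (sym (j+i-j≡i p (+ n)))) , adjacent

move-0110-balance : ∀ u v n → let l = length u in
  nth (u ++ true ∷ false ∷ false ∷ true ∷ v) n + δ (+ n) (+ (l + 1)) + δ (+ n) (+ (l + 2))
    ≡ nth (u ++ false ∷ true ∷ true ∷ false ∷ v) n + δ (+ n) (+ (l + 0)) + δ (+ n) (+ (l + 3))
move-0110-balance []      v 0                         = refl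
move-0110-balance []      v 1                         = refl
move-0110-balance []      v 2                         = refl
move-0110-balance []      v 3                         = refl
move-0110-balance []      v (suc (suc (suc (suc n)))) = refl
move-0110-balance (_ ∷ u) v zero                      = refl
move-0110-balance (_ ∷ u) v (suc n)
  rewrite δ-+-suc n (length u + 1) | δ-+-suc n (length u + 2)
        | δ-+-suc n (length u + 0) | δ-+-suc n (length u + 3) = move-0110-balance u v n

move-0110 : ∀ p u v → Move (place (u ++ false ∷ true ∷ true ∷ false ∷ v) p)
                           (place (u ++ true ∷ false ∷ false ∷ true ∷ v) p)
move-0110 p u v =
  move-between-holes q (at _ 0) (occupied 1 refl) (occupied 2 refl) (at _ 3) conserve
  where
  l = length u
  q = p ℤ.+ + l
  s = u ++ false ∷ true ∷ true ∷ false ∷ v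
  t = u ++ true ∷ false ∷ false ∷ true ∷ v

  at : ∀ w k → place (u ++ w) p (q ℤ.+ + k) ≡ nth w k
  at w k = begin
    place (u ++ w) p (q ℤ.+ + k)     ≡⟨ cong (place (u ++ w) p) (ℤₚ.+-assoc p (+ l) (+ k)) ⟩
    place (u ++ w) p (p ℤ.+ + (l + k)) ≡⟨ place-at (u ++ w) p (l + k) ⟩
    nth (u ++ w) (l + k)             ≡⟨ nth-++ʳ u w k ⟩
    nth w k                          ∎
    where open ≡-Reasoning

  occupied : ∀ k → nth (false ∷ true ∷ true ∷ false ∷ v) k ≡ 1 → place s p (q ℤ.+ + k) ≥ 1
  occupied k e = subst (_≥ 1) (sym (trans (at _ k) e)) (s≤s z≤n)

  δ-pattern : ∀ x k → δ x (q ℤ.+ + k) ≡ δ (x - p) (+ (l + k))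
  δ-pattern x k = trans (cong (δ x) (ℤₚ.+-assoc p (+ l) (+ k))) (δ-at p x (l + k))

  pointwise : ∀ z → nthℤ t z + δ z (+ (l + 1)) + δ z (+ (l + 2))
                  ≡ nthℤ s z + δ z (+ (l + 0)) + δ z (+ (l + 3))
  pointwise (+ n)    = move-0110-balance u v n
  pointwise -[1+ _ ] = refl

  conserve : ∀ x → place t p x + δ x (q ℤ.+ + 1) + δ x (q ℤ.+ + 2)
                 ≡ place s p x + δ x (q ℤ.+ + 0) + δ x (q ℤ.+ + 3)
  conserve x rewrite place-nthℤ t p x | place-nthℤ s p x
                   | δ-pattern x 0 | δ-pattern x 1 | δ-pattern x 2 | δ-pattern x 3 = pointwise (x - p)

10^_ : ℕ → List Bool
10^ zero  = []
10^ suc n = true ∷ false ∷ 10^ n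

01^_ : ℕ → List Bool
01^ zero  = []
01^ suc n = false ∷ true ∷ 01^ n

10^-suc : ∀ j w → 10^ suc j ++ w ≡ 10^ j ++ true ∷ false ∷ w
10^-suc zero    w = refl
10^-suc (suc j) w = cong (λ w′ → true ∷ false ∷ w′) (10^-suc j w)

adjacent-10^++ : ∀ j {w n} → AdjacentOnes (10^ j ++ w) n →
                 ∃ λ n′ → n ≡ length (10^ j) + n′ × AdjacentOnes w n′
adjacent-10^++ zero                          adjacent = _ , refl , adjacent
adjacent-10^++ (suc j) {n = zero}            (_ , ())
adjacent-10^++ (suc j) {n = suc zero}        (() , _)
adjacent-10^++ (suc j) {n = suc (suc n)} adjacent with adjacent-10^++ j adjacent
... | n′ , refl , adjacent′ = n′ , refl , adjacent′

no-adjacent-01^ : ∀ m n → ¬ AdjacentOnes (01^ m) n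
no-adjacent-01^ zero          n             (() , _)
no-adjacent-01^ (suc m)       zero          (() , _)
no-adjacent-01^ (suc zero)    (suc zero)    (_ , ())
no-adjacent-01^ (suc (suc m)) (suc zero)    (_ , ())
no-adjacent-01^ (suc m)       (suc (suc n)) adjacent = no-adjacent-01^ m n adjacent

no-adjacent-10^++01^ : ∀ d m n → ¬ AdjacentOnes (10^ d ++ 01^ m) n
no-adjacent-10^++01^ d m n adjacent with adjacent-10^++ d adjacent
... | n′ , _ , adjacent′ = no-adjacent-01^ m n′ adjacent′

adjacent-01∷10^++01^ : ∀ m d n → AdjacentOnes (false ∷ true ∷ 10^ d ++ 01^ m) n →
                       ∃ λ d′ → d ≡ suc d′ × n ≡ 1
adjacent-01∷10^++01^ m       d       zero          (() , _)
adjacent-01∷10^++01^ m       (suc d) (suc zero)    _        = d , refl , refl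
adjacent-01∷10^++01^ zero    zero    (suc zero)    (_ , ())
adjacent-01∷10^++01^ (suc m) zero    (suc zero)    (_ , ())
adjacent-01∷10^++01^ m       d       (suc (suc n)) adjacent = ⊥-elim (no-adjacent-10^++01^ d m n adjacent)

stage : ℕ → ℕ → ℕ → List Bool
stage m j d = 10^ j ++ false ∷ true ∷ 10^ d ++ 01^ m

stage-adjacent : ∀ m j d {n} → AdjacentOnes (stage m j d) n →
                 ∃ λ d′ → d ≡ suc d′ × n ≡ length (10^ j) + 1
stage-adjacent m j d adjacent with adjacent-10^++ j adjacent
... | n′ , refl , adjacent′ with adjacent-01∷10^++01^ m d n′ adjacent′
...   | d′ , refl , refl = d′ , refl , refl

block-++-false∷ : ∀ a w → block (suc a) ++ false ∷ w ≡ 10^ suc a ++ w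
block-++-false∷ zero    w = refl
block-++-false∷ (suc a) w = cong (λ w′ → true ∷ false ∷ w′) (block-++-false∷ a w)

false∷block : ∀ b → false ∷ block (suc b) ≡ 01^ suc b
false∷block zero    = refl
false∷block (suc b) = cong (λ w → false ∷ true ∷ w) (false∷block b)

F-alternating : ∀ M a → suc a < M → F M (suc a) ≡ 10^ suc a ++ 01^ (M ∸ suc a)
F-alternating (suc M) a (s≤s a<M) = begin
  block (suc a) ++ false ∷ false ∷ block (M ∸ a)          ≡⟨ cong gapped M∸a≡1+b ⟩
  block (suc a) ++ false ∷ false ∷ block (suc b)          ≡⟨ block-++-false∷ a _ ⟩
  10^ suc a ++ false ∷ block (suc b)                      ≡⟨ cong (10^ suc a ++_) (false∷block b) ⟩
  10^ suc a ++ 01^ suc b                                  ≡⟨ cong (λ c → 10^ suc a ++ 01^ c) (sym M∸a≡1+b) ⟩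
  10^ suc a ++ 01^ (M ∸ a)                                ∎
  where
  open ≡-Reasoning
  b = M ∸ suc a
  M∸a≡1+b : M ∸ a ≡ suc b
  M∸a≡1+b = ℕₚ.+-∸-assoc 1 a<M
  gapped : ℕ → List Bool
  gapped c = block (suc a) ++ false ∷ false ∷ block c

initial≈first-stage : ∀ n a k → a < n →
  (λ x → δ x k + place (F (suc n) (suc a)) (k ℤ.+ + 1) x) ≈ place (stage (n ∸ a) 0 (suc a)) (k - + 1)
initial≈first-stage n a k a<n x = begin
  δ x k + place (F (suc n) (suc a)) (k ℤ.+ + 1) x
    ≡⟨ cong (λ w → δ x k + place w (k ℤ.+ + 1) x) (F-alternating (suc n) a (s≤s a<n)) ⟩
  δ x k + place (10^ suc a ++ 01^ (n ∸ a)) (k ℤ.+ + 1) x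
    ≡⟨ sym (place-01∷ _ k x) ⟩
  place (stage (n ∸ a) 0 (suc a)) (k - + 1) x ∎
  where open ≡-Reasoning

F-last-stage : ∀ n a → a < n → F (suc n + 1) (suc a) ≡ stage (n ∸ a) (suc a) 0
F-last-stage n a a<n = begin
  F (suc n + 1) (suc a)                 ≡⟨ F-alternating (suc n + 1) a (s≤s (ℕₚ.m≤n⇒m≤n+o 1 a<n)) ⟩
  10^ suc a ++ 01^ ((n + 1) ∸ a)        ≡⟨ cong (λ c → 10^ suc a ++ 01^ c) n+1∸a≡1+n∸a ⟩
  stage (n ∸ a) (suc a) 0               ∎
  where
  open ≡-Reasoning
  n+1∸a≡1+n∸a : (n + 1) ∸ a ≡ suc (n ∸ a)
  n+1∸a≡1+n∸a = trans (ℕₚ.+-∸-comm 1 (ℕₚ.<⇒≤ a<n)) (ℕₚ.+-comm (n ∸ a) 1)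

module Stages (m : ℕ) (p : ℤ) where

  Stage : ℕ → ℕ → State
  Stage j d = place (stage m j d) p

  pair-room : ℕ → ℤ
  pair-room j = (p ℤ.+ + length (10^ j)) ℤ.+ + 1

  Stage-move : ∀ j d → Move (Stage j (suc d)) (Stage (suc j) d)
  Stage-move j d = subst (Move (Stage j (suc d))) (cong (λ w → place w p) (sym (10^-suc j _)))
                   (move-0110 p (10^ j) (10^ d ++ 01^ m))

  Stage-adjacent : ∀ {j d i} → Stage j d i ≥ 1 → Stage j d (i ℤ.+ + 1) ≥ 1 →
                   ∃ λ d′ → d ≡ suc d′ × pair-room j ≡ i
  Stage-adjacent {j} {d} {i} si≥1 si+1≥1 =
    let (n , i≡p+n , adjacent) = adjacent-place (stage m j d) p i si≥1 si+1≥1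
        (d′ , d≡1+d′ , n≡l+1)  = stage-adjacent m j d adjacent
    in  d′ , d≡1+d′ , trans (ℤₚ.+-assoc p (+ length (10^ j)) (+ 1))
                            (trans (cong (λ c → p ℤ.+ + c) (sym n≡l+1)) (sym i≡p+n))

  Stage-final : ∀ j → Final (Stage j 0)
  Stage-final j (i , si≥1 , si+1≥1) =
    ℕₚ.0≢1+n (proj₁ (proj₂ (Stage-adjacent {j} {0} {i} si≥1 si+1≥1)))

  Stage-move-unique : ∀ {j d u} → Move (Stage j (suc d)) u → u ≈ Stage (suc j) d
  Stage-move-unique {j} {d} mv@(i , _ , _ , si≥1 , si+1≥1 , _) x =
    trans (sym (move-deterministic (move-0110 p (10^ j) (10^ d ++ 01^ m)) mv pair-room≡i x))
          (cong (λ w → place w p x) (sym (10^-suc j _)))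
    where
    pair-room≡i : pair-room j ≡ i
    pair-room≡i = proj₂ (proj₂ (Stage-adjacent {j} {suc d} {i} si≥1 si+1≥1))

  reaches-last-stage : ∀ j d {s} → s ≈ Stage j (suc d) → Reachable s (Stage (j + suc d) 0)
  reaches-last-stage j zero {s} s≈Stage =
    subst (λ c → Reachable s (Stage c 0)) (sym (ℕₚ.+-comm j 1))
          (move-resp s≈Stage (Stage-move j 0) ◅ ε)
  reaches-last-stage j (suc d) {s} s≈Stage =
    subst (λ c → Reachable s (Stage c 0)) (sym (ℕₚ.+-suc j (suc d)))
          (move-resp s≈Stage (Stage-move j (suc d)) ◅ reaches-last-stage (suc j) d (λ _ → refl))

  final≈last-stage : ∀ j d {s u} → s ≈ Stage j d → Reachable s u → Final u → u ≈ Stage (j + d) 0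
  final≈last-stage j zero {s} s≈Stage ε _ =
    subst (λ c → s ≈ Stage c 0) (sym (ℕₚ.+-identityʳ j)) s≈Stage
  final≈last-stage j (suc d) s≈Stage ε u-final =
    ⊥-elim (final-no-move u-final (move-resp s≈Stage (Stage-move j d)))
  final≈last-stage j zero    s≈Stage (mv ◅ _) _ =
    ⊥-elim (final-no-move (Stage-final j) (move-resp (λ x → sym (s≈Stage x)) mv))
  final≈last-stage j (suc d) {u = u} s≈Stage (mv ◅ mvs) u-final =
    subst (λ c → u ≈ Stage c 0) (sym (ℕₚ.+-suc j d))
          (final≈last-stage (suc j) d (Stage-move-unique (move-resp (λ x → sym (s≈Stage x)) mv))
                            mvs u-final)

lemma5p13 : (N r : ℕ) (k : ℤ) → 2 ≤ N → 1 ≤ r → r ≤ N ∸ 1 →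
    let s₀ : State
        s₀ = λ x → δ x k + place (F N r) (k Data.Integer.+ + 1) x
        t : State
        t = place (F (N + 1) r) (k - + 1)
    in (Reachable s₀ t × Final t)
       × (∀ u → Reachable s₀ u → Final u → u ≈ t)
lemma5p13 (suc n) (suc a) k _ _ a<n =
    (subst (Reachable _) target (reaches-last-stage 0 a initial) , subst Final target (Stage-final (suc a)))
  , λ u s₀↝u u-final x → trans (final≈last-stage 0 (suc a) initial s₀↝u u-final x) (cong-app target x)
  where
  open Stages (n ∸ a) (k - + 1)
  initial : (λ x → δ x k + place (F (suc n) (suc a)) (k ℤ.+ + 1) x) ≈ Stage 0 (suc a)
  initial = initial≈first-stage n a k a<n
  target : Stage (suc a) 0 ≡ place (F (suc n + 1) (suc a)) (k - + 1)
  target = cong (λ w → place w (k - + 1)) (sym (F-last-stage n a a<n))
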